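{- For every $n\ge 1$, $\mathrm{thin}_{prec}(CR_n)=\max(1,n-1)$.
   Context: The crown graph $CR_n$ is obtained from $K_{n,n}$ by removing a perfect matching. An ordering $<$ of $V(G)$ is consistent with a partition $\mathcal{V}$ if for every $p<q<r$ with $p,q$ in the same class and $pr\in E(G)$, also $qr\in E(G)$. The precedence thinness $\mathrm{thin}_{prec}(G)$ is the minimum $k$ such that there exist a partition of $V(G)$ into $k$ classes and an ordering consistent with it in which the vertices of each class are consecutive. -}

module Defs where

open import Data.Nat using (ℕ; _<_; _≤_)
open import Data.Fin using (Fin)
open import Data.Bool using (Bool)
open import Data.Product using (_×_; Σ; ∃; ∃-syntax; _,_)
open import Relation.Binary.PropositionalEquality using (_≡_; _≢_)
open import Function.Definitions using (Injective; Surjective)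

record Graph : Set₁ where
  field
    V : Set
    E : V → V → Set

-- Crown graph CR_n: K_{n,n} (sides Bool, vertices Fin n on each side)
-- minus the perfect matching {(false,i),(true,i)}.
CR : ℕ → Graph
CR n = record
  { V = Bool × Fin n
  ; E = λ { (a , i) (b , j) → (a ≢ b) × (i ≢ j) } }

module _ (G : Graph) where
  open Graph G

  -- A linear order on V is represented by an injective position map
  -- pos : V → ℕ, with p < q iff pos p < pos q.
  -- A partition into k classes is a surjective class map c : V → Fin k.

  Consistent : {k : ℕ} → (V → Fin k) → (V → ℕ) → Set
  Consistent c pos = ∀ p q r → pos p < pos q → pos q < pos r →
    c p ≡ c q → E p r → E q r

  Consecutive : {k : ℕ} → (V → Fin k) → (V → ℕ) → Set
  Consecutive c pos = ∀ p q r → pos p < pos q → pos q < pos r →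
    c p ≡ c r → c q ≡ c p

  PrecThinWitness : ℕ → Set
  PrecThinWitness k = Σ (V → Fin k) λ c → Surjective _≡_ _≡_ c ×
    Σ (V → ℕ) λ pos → Injective _≡_ _≡_ pos ×
      Consistent c pos × Consecutive c pos

  ThinPrecIs : ℕ → Set
  ThinPrecIs k = PrecThinWitness k × (∀ k′ → PrecThinWitness k′ → k ≤ k′)

module Submission where

-- Call a vertex first if it precedes its twin, the vertex with the same index on the other side.
-- Consistency forbids two first vertices on one side in a common class, and forbids any first vertex
-- on side t after a class in which a first vertex on side s precedes one on side t ≠ s.  Together
-- with consecutiveness, no class holds three first vertices and at most one class holds two, so the
-- n first vertices need at least n - 1 classes.
-- For n = k + 2, k + 1 classes suffice.  Class c < k holds (isOdd c , c) followed, if c > 0, by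
-- (isOdd c , c - 1), whose twin lies in the earlier class c - 1; hence every later neighbour of the
-- first is a neighbour of the second.  The last class holds the remaining five vertices in an order
-- in which only consecutive ones are adjacent.

open import Defs
open import Data.Nat
open import Data.Nat.Properties
open import Data.Fin using (Fin; zero; suc; toℕ; fromℕ<; inject₁; punchIn)
open import Data.Fin.Properties
  using ( nonZeroIndex; toℕ-injective; toℕ-fromℕ<; fromℕ<-injective; fromℕ<-cong; toℕ-inject₁; toℕ<n
        ; pigeonhole; punchIn-injective; punchInᵢ≢i)
  renaming (_≟_ to _≟ᶠ_; <⇒≢ to <⇒≢ᶠ)
open import Data.Bool using (Bool; true; false; not; _xor_) renaming (_≟_ to _≟ᵇ_)
open import Data.Bool.Properties
  using (not-¬; ¬-not; not-involutive; not-distribˡ-xor; xor-same; xor-assoc; xor-identityʳ)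
open import Data.Product using (Σ; _×_; _,_; proj₁; proj₂)
open import Data.Product.Relation.Binary.Lex.Strict using (×-Lex)
open import Data.Empty using (⊥; ⊥-elim)
open import Data.Sum using (_⊎_; inj₁; inj₂)
open import Relation.Binary.PropositionalEquality
open import Relation.Binary.Definitions using (tri<; tri≈; tri>)
open import Relation.Nullary using (¬_; Dec; yes; no; contradiction)
open import Relation.Nullary.Decidable using (from-yes; ¬?; _→-dec_)
open import Function using (_∘_)
open import Function.Definitions using (Injective; Surjective)

TripleFree : ∀ {n k} → (Fin n → Fin k) → Set
TripleFree f = ∀ {i j l} → i ≢ j → i ≢ l → j ≢ l → f i ≡ f j → f i ≢ f l

CollisionsInOneFibre : ∀ {n k} → (Fin n → Fin k) → Set
CollisionsInOneFibre f = ∀ {i j i′ j′} → i ≢ j → i′ ≢ j′ → f i ≡ f j → f i′ ≡ f j′ → f i ≡ f i′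

collisionsInOneFibre⇒≤suc : ∀ {n k} (f : Fin n → Fin k) → TripleFree f → CollisionsInOneFibre f →
                            n ≤ suc k
collisionsInOneFibre⇒≤suc {zero}      f _        _        = z≤n
collisionsInOneFibre⇒≤suc {suc m} {k} f noTriple oneFibre = ≮⇒≥ λ { (s≤s k<m) → collide k<m }
  where
  collide : k < m → ⊥
  collide k<m with pigeonhole (m<n⇒m<1+n k<m) f
  ... | i , j , i<j , fi≡fj with pigeonhole k<m (λ l → f (punchIn i l))
  ... | l₁ , l₂ , l₁<l₂ , fl₁≡fl₂ =
    noTriple (i≢punchIn l₁) (i≢punchIn l₂) punchIns-distinct fi≡fl₁ (trans fi≡fl₁ fl₁≡fl₂)
    where
    i≢punchIn : ∀ l → i ≢ punchIn i l
    i≢punchIn l eq = punchInᵢ≢i i l (sym eq)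
    punchIns-distinct : punchIn i l₁ ≢ punchIn i l₂
    punchIns-distinct eq = <⇒≢ᶠ l₁<l₂ (punchIn-injective i l₁ l₂ eq)
    fi≡fl₁ : f i ≡ f (punchIn i l₁)
    fi≡fl₁ = oneFibre (<⇒≢ᶠ i<j) punchIns-distinct fi≡fj fl₁≡fl₂

bool-pigeonhole : ∀ (x y z : Bool) → x ≡ y ⊎ x ≡ z ⊎ y ≡ z
bool-pigeonhole true  true  _     = inj₁ refl
bool-pigeonhole false false _     = inj₁ refl
bool-pigeonhole true  false true  = inj₂ (inj₁ refl)
bool-pigeonhole true  false false = inj₂ (inj₂ refl)
bool-pigeonhole false true  true  = inj₂ (inj₂ refl)
bool-pigeonhole false true  false = inj₂ (inj₁ refl)

≢⇒≡⊎≡ : ∀ {s t} u → s ≢ t → u ≡ s ⊎ u ≡ t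
≢⇒≡⊎≡ {s} u s≢t with u ≟ᵇ s
... | yes u≡s = inj₁ u≡s
... | no  u≢s = inj₂ (trans (¬-not u≢s) (sym (¬-not (s≢t ∘ sym))))

twin : ∀ {n} → Bool × Fin n → Bool × Fin n
twin (s , i) = not s , i

module CrownLowerBound {n k} (c : Bool × Fin n → Fin k) (pos : Bool × Fin n → ℕ)
  (pos-injective : Injective _≡_ _≡_ pos) (consistent : Consistent (CR n) c pos)
  (consecutive : Consecutive (CR n) c pos) where

  compareDistinct : ∀ {u v} → u ≢ v → pos u < pos v ⊎ pos v < pos u
  compareDistinct {u} {v} u≢v with <-cmp (pos u) (pos v)
  ... | tri< u<v _ _ = inj₁ u<v
  ... | tri≈ _ eq _  = contradiction (pos-injective eq) u≢v
  ... | tri> _ _ v<u = inj₂ v<u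

  First : Bool × Fin n → Set
  First v = pos v < pos (twin v)

  firstSide : (i : Fin n) → Σ Bool λ s → First (s , i)
  firstSide i with compareDistinct {false , i} {true , i} (λ ())
  ... | inj₁ f<t = false , f<t
  ... | inj₂ t<f = true , t<f

  first : Fin n → Bool × Fin n
  first i = proj₁ (firstSide i) , i

  notFirst-afterSameSide : ∀ {s i j} → pos (s , i) < pos (s , j) → c (s , i) ≡ c (s , j) → i ≢ j →
                           ¬ First (s , j)
  notFirst-afterSameSide {s} i<j same i≢j j-first =
    proj₂ (consistent (s , _) (s , _) (not s , _) i<j j-first same (not-¬ refl , i≢j)) refl

  firsts-sameSide : ∀ {s i j} → First (s , i) → First (s , j) → c (s , i) ≡ c (s , j) → i ≡ j
  firsts-sameSide {s} {i} {j} i-first j-first same with i ≟ᶠ j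
  ... | yes i≡j = i≡j
  ... | no  i≢j with compareDistinct {s , i} {s , j} (λ eq → i≢j (cong proj₂ eq))
  ...   | inj₁ i<j = contradiction j-first (notFirst-afterSameSide i<j same i≢j)
  ...   | inj₂ j<i = contradiction i-first (notFirst-afterSameSide j<i (sym same) (i≢j ∘ sym))

  -- A later (t , l) with l ≢ i would see (s , i) but not (t , j); (t , i) is first, so it precedes (s , i).
  noFirst-afterCrossPair : ∀ {s t i j l} → s ≢ t → c (s , i) ≡ c (t , j) → pos (s , i) < pos (t , j) →
                           pos (t , j) < pos (t , l) → ¬ First (t , l)
  noFirst-afterCrossPair {s} {t} {i} {j} {l} s≢t same i<j j<l l-first with l ≟ᶠ i
  ... | no  l≢i  = proj₁ (consistent (s , i) (t , j) (t , l) i<j j<l same (s≢t , l≢i ∘ sym)) refl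
  ... | yes refl = <-irrefl refl (<-trans i<j (<-trans j<l l<s))
    where
    l<s : pos (t , l) < pos (s , l)
    l<s = subst (λ u → pos (t , l) < pos (u , l)) (sym (¬-not s≢t)) l-first

  record CrossPair : Set where
    field
      {s t}     : Bool
      {i j}     : Fin n
      s≢t       : s ≢ t
      first-s   : First (s , i)
      first-t   : First (t , j)
      sameClass : c (s , i) ≡ c (t , j)
      ordered   : pos (s , i) < pos (t , j)

    class : Fin k
    class = c (s , i)

  open CrossPair

  -- Q must start after P ends (consecutiveness), so one of Q's two first vertices lies on P's later side.
  crossPairs-notSeparated : (P Q : CrossPair) → class P ≢ class Q → pos (t P , j P) < pos (t Q , j Q) → ⊥
  crossPairs-notSeparated P Q P≢Q Pt<Qt = go (compareDistinct {s Q , i Q} {t P , j P} Qs≢Pt)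
    where
    Qs≢Pt : (s Q , i Q) ≢ (t P , j P)
    Qs≢Pt eq = P≢Q (trans (sameClass P) (cong c (sym eq)))

    go : pos (s Q , i Q) < pos (t P , j P) ⊎ pos (t P , j P) < pos (s Q , i Q) → ⊥
    go (inj₁ Qs<Pt) =
      P≢Q (trans (sameClass P) (consecutive (s Q , i Q) (t P , j P) (t Q , j Q) Qs<Pt Pt<Qt (sameClass Q)))
    go (inj₂ Pt<Qs) with ≢⇒≡⊎≡ (t P) (s≢t Q)
    ... | inj₁ refl = noFirst-afterCrossPair (s≢t P) (sameClass P) (ordered P) Pt<Qs (first-s Q)
    ... | inj₂ refl = noFirst-afterCrossPair (s≢t P) (sameClass P) (ordered P) Pt<Qt (first-t Q)

  crossPairs-sameClass : (P Q : CrossPair) → class P ≡ class Q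
  crossPairs-sameClass P Q with class P ≟ᶠ class Q
  ... | yes P≡Q = P≡Q
  ... | no  P≢Q with <-cmp (pos (t P , j P)) (pos (t Q , j Q))
  ...   | tri< Pt<Qt _ _ = ⊥-elim (crossPairs-notSeparated P Q P≢Q Pt<Qt)
  ...   | tri≈ _ eq _    =
    ⊥-elim (P≢Q (trans (sameClass P) (trans (cong c (pos-injective eq)) (sym (sameClass Q)))))
  ...   | tri> _ _ Qt<Pt = ⊥-elim (crossPairs-notSeparated Q P (P≢Q ∘ sym) Qt<Pt)

  firstClass : Fin n → Fin k
  firstClass i = c (first i)

  crossPair : ∀ {i j} → i ≢ j → firstClass i ≡ firstClass j → Σ CrossPair λ P → class P ≡ firstClass i
  crossPair {i} {j} i≢j same with firstSide i | firstSide j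
  ... | a , i-first | b , j-first with a ≟ᵇ b
  ...   | yes refl = contradiction (firsts-sameSide i-first j-first same) i≢j
  ...   | no  a≢b with compareDistinct {a , i} {b , j} (i≢j ∘ cong proj₂)
  ...     | inj₁ i<j = record { s≢t = a≢b ; first-s = i-first ; first-t = j-first
                              ; sameClass = same ; ordered = i<j } , refl
  ...     | inj₂ j<i = record { s≢t = a≢b ∘ sym ; first-s = j-first ; first-t = i-first
                              ; sameClass = sym same ; ordered = j<i } , sym same

  firstClass-tripleFree : TripleFree firstClass
  firstClass-tripleFree {i} {j} {l} i≢j i≢l j≢l ij il
    with firstSide i | firstSide j | firstSide l
  ... | a , i-first | b , j-first | d , l-first with bool-pigeonhole a b d
  ...   | inj₁ refl        = i≢j (firsts-sameSide i-first j-first ij)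
  ...   | inj₂ (inj₁ refl) = i≢l (firsts-sameSide i-first l-first il)
  ...   | inj₂ (inj₂ refl) = j≢l (firsts-sameSide j-first l-first (trans (sym ij) il))

  firstClass-collisionsInOneFibre : CollisionsInOneFibre firstClass
  firstClass-collisionsInOneFibre i≢j i′≢j′ ij i′j′ with crossPair i≢j ij | crossPair i′≢j′ i′j′
  ... | P , P≡i | Q , Q≡i′ = trans (sym P≡i) (trans (crossPairs-sameClass P Q) Q≡i′)

  n≤suc-classes : n ≤ suc k
  n≤suc-classes = collisionsInOneFibre⇒≤suc firstClass firstClass-tripleFree firstClass-collisionsInOneFibre

encode : ℕ → ℕ × ℕ → ℕ
encode b (c , s) = c * b + s

encode-mono : ∀ {b c s c′ s′} → s < b → ×-Lex _≡_ _<_ _<_ (c , s) (c′ , s′) →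
              encode b (c , s) < encode b (c′ , s′)
encode-mono {b} {c} {s} {c′} {s′} s<b (inj₁ c<c′) = begin-strict
  c * b + s    <⟨ +-monoʳ-< (c * b) s<b ⟩
  c * b + b    ≡⟨ +-comm (c * b) b ⟩
  suc c * b    ≤⟨ *-monoˡ-≤ b c<c′ ⟩
  c′ * b       ≤⟨ m≤m+n (c′ * b) s′ ⟩
  c′ * b + s′  ∎
  where open ≤-Reasoning
encode-mono {b} {c} _ (inj₂ (refl , s<s′)) = +-monoʳ-< (c * b) s<s′

encode-reflects : ∀ {b c s c′ s′} → s′ < b →
                  encode b (c , s) < encode b (c′ , s′) → ×-Lex _≡_ _<_ _<_ (c , s) (c′ , s′)
encode-reflects {b} {c} {s} {c′} {s′} s′<b lt with <-cmp c c′
... | tri< c<c′ _ _ = inj₁ c<c′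
... | tri≈ _ refl _ = inj₂ (refl , +-cancelˡ-< (c * b) s s′ lt)
... | tri> _ _ c′<c = contradiction lt (<-asym (encode-mono s′<b (inj₁ c′<c)))

encode-injective : ∀ {b c s c′ s′} → s < b → s′ < b →
                   encode b (c , s) ≡ encode b (c′ , s′) → (c , s) ≡ (c′ , s′)
encode-injective {b} {c} {s} {c′} {s′} s<b s′<b eq with <-cmp c c′
... | tri< c<c′ _ _ = contradiction eq (<⇒≢ (encode-mono s<b (inj₁ c<c′)))
... | tri≈ _ refl _ = cong (c ,_) (+-cancelˡ-≡ (c * b) s s′ eq)
... | tri> _ _ c′<c = contradiction (sym eq) (<⇒≢ (encode-mono s′<b (inj₁ c′<c)))

module BlockOrder (G : Graph) {k b : ℕ} (class : Graph.V G → ℕ) (class≤ : ∀ v → class v ≤ k)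
                  (slot : Graph.V G → ℕ) (slot< : ∀ v → slot v < b) where
  open Graph G

  block : V → Fin (suc k)
  block v = fromℕ< (s≤s (class≤ v))

  position : V → ℕ
  position v = encode b (class v , slot v)

  block⇒class : ∀ u v → block u ≡ block v → class u ≡ class v
  block⇒class u v = fromℕ<-injective (class u) (class v) _ _

  position-lex : ∀ u v → position u < position v → ×-Lex _≡_ _<_ _<_ (class u , slot u) (class v , slot v)
  position-lex u v = encode-reflects (slot< v)

  position-class-mono : ∀ u v → position u < position v → class u ≤ class v
  position-class-mono u v u<v with position-lex u v u<v
  ... | inj₁ c<c′       = <⇒≤ c<c′
  ... | inj₂ (c≡c′ , _) = ≤-reflexive c≡c′

  position-slot-mono : ∀ u v → class u ≡ class v → position u < position v → slot u < slot v
  position-slot-mono u v same u<v with position-lex u v u<v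
  ... | inj₁ c<c′       = contradiction same (<⇒≢ c<c′)
  ... | inj₂ (_ , s<s′) = s<s′

  blocks-consecutive : Consecutive G block position
  blocks-consecutive p q r p<q q<r pr = fromℕ<-cong (class q) (class p) q≡p _ _
    where
    q≡p : class q ≡ class p
    q≡p = ≤-antisym (≤-trans (position-class-mono q r q<r) (≤-reflexive (sym (block⇒class p r pr))))
                    (position-class-mono p q p<q)

twinFirst-inherits : ∀ {n} (pos : Bool × Fin n → ℕ) {a i j e l} →
                     pos (twin (a , j)) < pos (a , j) → pos (a , j) < pos (e , l) →
                     Graph.E (CR n) (a , i) (e , l) → Graph.E (CR n) (a , j) (e , l)
twinFirst-inherits pos {a} {j = j} {e} twin<q q<r (a≢e , _) = a≢e , j≢l
  where
  j≢l : j ≢ _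
  j≢l refl = <-asym q<r (subst (λ x → pos (x , j) < pos (a , j)) (sym (¬-not (a≢e ∘ sym))) twin<q)

isOdd : ℕ → Bool
isOdd zero    = false
isOdd (suc t) = not (isOdd t)

xor-cancelʳ : ∀ x y → (x xor y) xor y ≡ x
xor-cancelʳ x y = trans (xor-assoc x y y) (trans (cong (x xor_) (xor-same y)) (xor-identityʳ x))

-- In the last block the vertex at slot s lies on side isOdd s xor isOdd k and has index
-- k - 1 + (s + 1) % 3, so only vertices at neighbouring slots can be adjacent.
slotPattern-adjacent⇒consecutive : ∀ {x z} → x < z → z < 5 → isOdd x ≢ isOdd z →
                                   suc x % 3 ≢ suc z % 3 → z ≡ suc x
slotPattern-adjacent⇒consecutive x<z z<5 =
  from-yes (allUpTo? (λ z → allUpTo? (λ x → adjacent⇒consecutive? x z) z) 5) z<5 x<z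
  where
  adjacent⇒consecutive? : ∀ x z → Dec (isOdd x ≢ isOdd z → suc x % 3 ≢ suc z % 3 → z ≡ suc x)
  adjacent⇒consecutive? x z =
    ¬? (isOdd x ≟ᵇ isOdd z) →-dec ¬? (suc x % 3 ≟ suc z % 3) →-dec z ≟ suc x

module CrownConstruction (k : ℕ) where

  data Zone : ℕ → Set where
    early : ∀ {t} → t < k → Zone t
    pivot : Zone k
    final : Zone (suc k)

  zone : ∀ {t} → t ≤ suc k → Zone t
  zone {t} t≤1+k with <-cmp t k
  ... | tri< t<k _ _ = early t<k
  ... | tri≈ _ refl _ = pivot
  ... | tri> _ _ k<t with ≤-antisym t≤1+k k<t
  ...   | refl = final

  -- The flag f marks the vertex of index t on side not (isOdd t).  Block c < k lists
  -- (isOdd c , c) and then, if c > 0, (isOdd c , c - 1); block k lists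
  -- (P , k), (¬P , k+1), (P , k-1), (¬P , k), (P , k+1) where P = isOdd k.
  classIn : ∀ {t} → Zone t → Bool → ℕ
  classIn (early {t} _) false = t
  classIn (early {t} _) true  = suc t
  classIn pivot         _     = k
  classIn final         _     = k

  slotIn : ∀ {t} → Zone t → Bool → ℕ
  slotIn (early _) false = 0
  slotIn (early _) true  = 2
  slotIn pivot     false = 0
  slotIn pivot     true  = 3
  slotIn final     false = 1
  slotIn final     true  = 4

  indexAt : ℕ → ℕ → ℕ
  indexAt c 1 = suc c
  indexAt c 2 = pred c
  indexAt c 4 = suc c
  indexAt c _ = c

  secondaryAt : ℕ → Bool
  secondaryAt 0 = false
  secondaryAt 1 = false
  secondaryAt _ = true

  decode : ∀ {t} (z : Zone t) f → indexAt (classIn z f) (slotIn z f) ≡ t × secondaryAt (slotIn z f) ≡ f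
  decode (early _) false = refl , refl
  decode (early _) true  = refl , refl
  decode pivot     false = refl , refl
  decode pivot     true  = refl , refl
  decode final     false = refl , refl
  decode final     true  = refl , refl

  placement-injective : ∀ {t t′} (z : Zone t) (z′ : Zone t′) f f′ →
                        (classIn z f , slotIn z f) ≡ (classIn z′ f′ , slotIn z′ f′) → t ≡ t′ × f ≡ f′
  placement-injective z z′ f f′ eq =
      trans (sym (proj₁ (decode z f))) (trans (cong (λ (c , s) → indexAt c s) eq) (proj₁ (decode z′ f′)))
    , trans (sym (proj₂ (decode z f))) (trans (cong (λ (_ , s) → secondaryAt s) eq) (proj₂ (decode z′ f′)))

  classIn≤ : ∀ {t} (z : Zone t) f → classIn z f ≤ k
  classIn≤ (early t<k) false = <⇒≤ t<k
  classIn≤ (early t<k) true  = t<k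
  classIn≤ pivot       _     = ≤-refl
  classIn≤ final       _     = ≤-refl

  slotIn<5 : ∀ {t} (z : Zone t) f → slotIn z f < 5
  slotIn<5 (early _) false = s≤s z≤n
  slotIn<5 (early _) true  = s≤s (s≤s (s≤s z≤n))
  slotIn<5 pivot     false = s≤s z≤n
  slotIn<5 pivot     true  = s≤s (s≤s (s≤s (s≤s z≤n)))
  slotIn<5 final     false = s≤s (s≤s z≤n)
  slotIn<5 final     true  = ≤-refl

  classIn-primary : ∀ {t} (z : Zone t) → t ≤ k → classIn z false ≡ t
  classIn-primary (early _) _     = refl
  classIn-primary pivot     _     = refl
  classIn-primary final     1+k≤k = contradiction 1+k≤k 1+n≰n

  primaryIn-before-secondaryIn : ∀ {t} (z : Zone t) →
                                 ×-Lex _≡_ _<_ _<_ (classIn z false , slotIn z false)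
                                                   (classIn z true  , slotIn z true)
  primaryIn-before-secondaryIn (early _) = inj₁ ≤-refl
  primaryIn-before-secondaryIn pivot     = inj₂ (refl , s≤s z≤n)
  primaryIn-before-secondaryIn final     = inj₂ (refl , s≤s (s≤s z≤n))

  secondaryIn-early : ∀ {t} (z : Zone t) f → classIn z f < k → 0 < slotIn z f → f ≡ true
  secondaryIn-early (early _) true  _   _ = refl
  secondaryIn-early (early _) false _   ()
  secondaryIn-early pivot     _     k<k _ = contradiction k<k (<-irrefl refl)
  secondaryIn-early final     _     k<k _ = contradiction k<k (<-irrefl refl)

  sideIn-early : ∀ {t} (z : Zone t) f → classIn z f < k → f xor isOdd t ≡ isOdd (classIn z f)
  sideIn-early (early _) false _   = refl
  sideIn-early (early _) true  _   = refl
  sideIn-early pivot     _     k<k = contradiction k<k (<-irrefl refl)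
  sideIn-early final     _     k<k = contradiction k<k (<-irrefl refl)

  sideIn-last : ∀ {t} (z : Zone t) f → classIn z f ≡ k → f xor isOdd t ≡ isOdd (slotIn z f) xor isOdd k
  sideIn-last (early t<k) false refl = contradiction t<k (<-irrefl refl)
  sideIn-last (early _)   true  refl = refl
  sideIn-last pivot       false _    = refl
  sideIn-last pivot       true  _    = refl
  sideIn-last final       false _    = refl
  sideIn-last final       true  _    = not-involutive (isOdd k)

  indexIn-last : ∀ {t} (z : Zone t) f → classIn z f ≡ k → suc t ≡ k + suc (slotIn z f) % 3
  indexIn-last (early t<k) false refl = contradiction t<k (<-irrefl refl)
  indexIn-last (early _)   true  refl = sym (+-identityʳ _)
  indexIn-last pivot       false _    = +-comm 1 k
  indexIn-last pivot       true  _    = +-comm 1 k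
  indexIn-last final       false _    = +-comm 2 k
  indexIn-last final       true  _    = +-comm 2 k

  Vertex : Set
  Vertex = Bool × Fin (suc (suc k))

  zoneOf : (i : Fin (suc (suc k))) → Zone (toℕ i)
  zoneOf i = zone (s≤s⁻¹ (toℕ<n i))

  secondary : Vertex → Bool
  secondary (b , i) = b xor isOdd (toℕ i)

  class : Vertex → ℕ
  class v@(_ , i) = classIn (zoneOf i) (secondary v)

  slot : Vertex → ℕ
  slot v@(_ , i) = slotIn (zoneOf i) (secondary v)

  class≤ : ∀ v → class v ≤ k
  class≤ v@(_ , i) = classIn≤ (zoneOf i) (secondary v)

  slot<5 : ∀ v → slot v < 5
  slot<5 v@(_ , i) = slotIn<5 (zoneOf i) (secondary v)

  Crown : Graph
  Crown = CR (suc (suc k))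

  open BlockOrder Crown class class≤ slot slot<5

  side-from-secondary : ∀ v → proj₁ v ≡ secondary v xor isOdd (toℕ (proj₂ v))
  side-from-secondary (b , i) = sym (xor-cancelʳ b (isOdd (toℕ i)))

  position-injective : Injective _≡_ _≡_ position
  position-injective {b , i} {b′ , j} eq
    with placement-injective (zoneOf i) (zoneOf j) _ _ (encode-injective (slot<5 (b , i)) (slot<5 (b′ , j)) eq)
  ... | i≡j , same with toℕ-injective i≡j
  ... | refl = cong (_, i) (begin
    b                                ≡⟨ side-from-secondary (b , i) ⟩
    secondary (b , i) xor isOdd (toℕ i)  ≡⟨ cong (_xor isOdd (toℕ i)) same ⟩
    secondary (b′ , i) xor isOdd (toℕ i) ≡⟨ side-from-secondary (b′ , i) ⟨
    b′                               ∎)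
    where open ≡-Reasoning

  class-primary : ∀ i → toℕ i ≤ k → class (isOdd (toℕ i) , i) ≡ toℕ i
  class-primary i t≤k rewrite xor-same (isOdd (toℕ i)) = classIn-primary (zoneOf i) t≤k

  block-surjective : Surjective _≡_ _≡_ block
  block-surjective y = (isOdd (toℕ (inject₁ y)) , inject₁ y) , λ { refl → toℕ-injective (begin
      toℕ (block (isOdd (toℕ (inject₁ y)) , inject₁ y)) ≡⟨ toℕ-fromℕ< _ ⟩
      class (isOdd (toℕ (inject₁ y)) , inject₁ y)     ≡⟨ class-primary (inject₁ y) inject₁y≤k ⟩
      toℕ (inject₁ y)                                   ≡⟨ toℕ-inject₁ y ⟩
      toℕ y                                             ∎) }
    where
    open ≡-Reasoning
    inject₁y≤k : toℕ (inject₁ y) ≤ k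
    inject₁y≤k = subst (_≤ k) (sym (toℕ-inject₁ y)) (s≤s⁻¹ (toℕ<n y))

  twin-precedes-secondary : ∀ v → secondary v ≡ true → position (twin v) < position v
  twin-precedes-secondary (b , i) sec =
    subst₂ (λ f f′ → encode 5 (classIn z f , slotIn z f) < encode 5 (classIn z f′ , slotIn z f′))
           (sym twin-primary) (sym sec) (encode-mono (slotIn<5 z false) (primaryIn-before-secondaryIn z))
    where
    z = zoneOf i
    twin-primary : secondary (twin (b , i)) ≡ false
    twin-primary = trans (sym (not-distribˡ-xor b (isOdd (toℕ i)))) (cong not sec)

  earlyBlock-side : ∀ v → class v < k → proj₁ v ≡ isOdd (class v)
  earlyBlock-side v@(_ , i) c<k = trans (side-from-secondary v) (sideIn-early (zoneOf i) (secondary v) c<k)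

  lastBlock-side : ∀ v → class v ≡ k → proj₁ v ≡ isOdd (slot v) xor isOdd k
  lastBlock-side v@(_ , i) c≡k = trans (side-from-secondary v) (sideIn-last (zoneOf i) (secondary v) c≡k)

  lastBlock-adjacent⇒consecutive : ∀ u w → class u ≡ k → class w ≡ k → slot u < slot w →
                                   Graph.E Crown u w → slot w ≡ suc (slot u)
  lastBlock-adjacent⇒consecutive u@(a , i) w@(e , l) u≡k w≡k u<w (a≢e , i≢l) =
    slotPattern-adjacent⇒consecutive u<w (slot<5 w) sides-differ indices-differ
    where
    sides-differ : isOdd (slot u) ≢ isOdd (slot w)
    sides-differ eq =
      a≢e (trans (lastBlock-side u u≡k) (trans (cong (_xor isOdd k) eq) (sym (lastBlock-side w w≡k))))
    indices-differ : suc (slot u) % 3 ≢ suc (slot w) % 3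
    indices-differ eq = i≢l (toℕ-injective (suc-injective (begin
      suc (toℕ i)            ≡⟨ indexIn-last (zoneOf i) (secondary u) u≡k ⟩
      k + suc (slot u) % 3   ≡⟨ cong (k +_) eq ⟩
      k + suc (slot w) % 3   ≡⟨ indexIn-last (zoneOf l) (secondary w) w≡k ⟨
      suc (toℕ l)            ∎)))
      where open ≡-Reasoning

  lastBlock-noneBetween : ∀ p q r → class p ≡ k → class p ≡ class q → position p < position q →
                          position q < position r → ¬ Graph.E Crown p r
  lastBlock-noneBetween p q r p≡k same p<q q<r Epr =
    <⇒≱ p<q-slot (s≤s⁻¹ (subst (slot q <_) r≡next q<r-slot))
    where
    q≡k : class q ≡ k
    q≡k = trans (sym same) p≡k
    r≡k : class r ≡ k
    r≡k = ≤-antisym (class≤ r) (subst (_≤ class r) q≡k (position-class-mono q r q<r))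
    p<q-slot : slot p < slot q
    p<q-slot = position-slot-mono p q same p<q
    q<r-slot : slot q < slot r
    q<r-slot = position-slot-mono q r (trans q≡k (sym r≡k)) q<r
    r≡next : slot r ≡ suc (slot p)
    r≡next = lastBlock-adjacent⇒consecutive p r p≡k r≡k (<-trans p<q-slot q<r-slot) Epr

  earlyBlock-sameSide : ∀ u v → class u < k → class u ≡ class v → proj₁ u ≡ proj₁ v
  earlyBlock-sameSide u v u<k same =
    trans (earlyBlock-side u u<k) (trans (cong isOdd same) (sym (earlyBlock-side v (subst (_< k) same u<k))))

  earlyBlock-laterSecondary : ∀ u v → class u < k → class u ≡ class v → position u < position v →
                              secondary v ≡ true
  earlyBlock-laterSecondary u v@(_ , j) u<k same u<v =
    secondaryIn-early (zoneOf j) (secondary v) (subst (_< k) same u<k)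
                      (≤-trans (s≤s z≤n) (position-slot-mono u v same u<v))

  consistent : Consistent Crown block position
  consistent p@(a , i) q@(b , j) r@(e , l) p<q q<r pq Epr with m≤n⇒m<n∨m≡n (class≤ p)
  ... | inj₂ p≡k = contradiction Epr (lastBlock-noneBetween p q r p≡k (block⇒class p q pq) p<q q<r)
  ... | inj₁ p<k with earlyBlock-sameSide p q p<k (block⇒class p q pq)
  ...   | refl = twinFirst-inherits position (twin-precedes-secondary q q-secondary) q<r Epr
    where
    q-secondary : secondary q ≡ true
    q-secondary = earlyBlock-laterSecondary p q p<k (block⇒class p q pq) p<q

  witness : PrecThinWitness Crown (suc k)
  witness = block , block-surjective , position , position-injective , consistent , blocks-consecutive

CR₁-witness : PrecThinWitness (CR 1) 1
CR₁-witness = (λ _ → zero) , (λ { zero → (false , zero) , λ _ → refl }) ,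
              position , position-injective , consistent , (λ _ _ _ _ _ _ → refl)
  where
  position : Bool × Fin 1 → ℕ
  position (false , _) = 0
  position (true  , _) = 1
  position-injective : Injective _≡_ _≡_ position
  position-injective {false , zero} {false , zero} _ = refl
  position-injective {true  , zero} {true  , zero} _ = refl
  consistent : Consistent (CR 1) (λ _ → zero) position
  consistent (_ , zero) _ (_ , zero) _ _ _ (_ , 0≢0) = ⊥-elim (0≢0 refl)

thinPrec-lowerBound : ∀ m k → PrecThinWitness (CR (suc m)) k → 1 ⊔ m ≤ k
thinPrec-lowerBound m k (c , _ , pos , pos-injective , consistent , consecutive) =
  ⊔-lub (>-nonZero⁻¹ k {{nonZeroIndex (c (false , zero))}})
        (s≤s⁻¹ (CrownLowerBound.n≤suc-classes c pos pos-injective consistent consecutive))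

theorem19 : ∀ (n : ℕ) → 1 ≤ n → ThinPrecIs (CR n) (1 ⊔ (n ∸ 1))
theorem19 (suc zero)    _ = CR₁-witness , thinPrec-lowerBound 0
theorem19 (suc (suc k)) _ = CrownConstruction.witness k , thinPrec-lowerBound (suc k)
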